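{- Let $G$ be a stitched $2$-ichromatic ordered graph with vertices $v_1<\dots<v_{m+n}$ whose parts are $\{v_1, \ldots, v_m\}$ and $\{v_{m+1}, \ldots, v_{m+n}\}$. If $v_1v_{m+n}$ and $v_mv_{m+1}$ are edges of $G$, then $R(G) \geq 5r+1$, where $r = \min(m,n)-1$.
   Context: An ordered graph is a graph together with a linear ordering of its vertices. An ordered graph $H$ is contained in an ordered graph $H'$ if there is an order-preserving injection $V(H)\to V(H')$ mapping edges to edges. An interval coloring of an ordered graph is a partition of its vertex set into independent sets each consisting of consecutive vertices (called parts); the interval chromatic number is the minimum number of parts, and an ordered graph is $k$-ichromatic if its interval chromatic number is $k$. A $k$-ichromatic ordered graph is stitched if the set consisting of the first and last vertices of each part lies in a single connected component of the graph. The Ramsey number $R(G)$ of an ordered graph $G$ is the minimum $N$ such that every 2-coloring of the edges of the ordered complete graph on $N$ vertices contains a monochromatic copy of $G$ (in the ordered sense). -}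

module Defs where

open import Data.Nat using (ℕ; zero; suc; _+_; _*_; _∸_; _⊓_; _≤_; _<_)
open import Data.Fin using (Fin; toℕ)
open import Data.Bool using (Bool)
open import Data.Product using (Σ; ∃; _×_; _,_)
open import Relation.Nullary using (¬_)
open import Relation.Binary.PropositionalEquality using (_≡_)

-- An ordered (simple) graph on k vertices: vertex set Fin k with its natural
-- order; adjacency is a symmetric irreflexive relation.
record OrderedGraph (k : ℕ) : Set₁ where
  field
    E      : Fin k → Fin k → Set
    E-sym  : ∀ {i j} → E i j → E j i
    E-irr  : ∀ {i} → ¬ E i i
open OrderedGraph public

Independent : ∀ {k} → OrderedGraph k → (Fin k → Set) → Set
Independent G P = ∀ i j → P i → P j → ¬ E G i j

data Connected {k : ℕ} (G : OrderedGraph k) : Fin k → Fin k → Set where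
  here : ∀ {u} → Connected G u u
  step : ∀ {u v w} → E G u v → Connected G v w → Connected G u w

-- A 2-colouring of the ordered complete graph K_N is c : Fin N → Fin N → Bool,
-- where the colour of the edge {x,y} with x < y is c x y.
MonoCopy : ∀ {k} → OrderedGraph k → (N : ℕ) → (Fin N → Fin N → Bool) → Bool → Set
MonoCopy {k} G N c b =
  Σ (Fin k → Fin N) λ f →
    (∀ i j → toℕ i < toℕ j → toℕ (f i) < toℕ (f j)) ×
    (∀ i j → toℕ i < toℕ j → E G i j → c (f i) (f j) ≡ b)

RamseyProp : ∀ {k} → OrderedGraph k → ℕ → Set
RamseyProp G N = ∀ (c : Fin N → Fin N → Bool) → ∃ λ b → MonoCopy G N c b

-- R(G) ≥ L : every N with the Ramsey property for G is at least L
-- (R(G) is the least such N).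
RamseyGE : ∀ {k} → OrderedGraph k → ℕ → Set
RamseyGE G L = ∀ N → RamseyProp G N → L ≤ N

-- Vertices v_1 < ... < v_{m+n} are indexed by Fin (m + n), v_i ↦ index i-1.
-- G is 2-ichromatic with parts {v_1..v_m}, {v_{m+1}..v_{m+n}}:
-- both parts nonempty and independent, and G has interval chromatic number
-- not 1 (the whole vertex set is not independent).
TwoIchromaticParts : (m n : ℕ) → OrderedGraph (m + n) → Set
TwoIchromaticParts m n G =
  (1 ≤ m) × (1 ≤ n) ×
  Independent G (λ i → toℕ i < m) ×
  Independent G (λ i → m ≤ toℕ i) ×
  ¬ Independent G (λ _ → Data.Unit.⊤)
  where import Data.Unit

Endpoint : (m n : ℕ) → Fin (m + n) → Set
Endpoint m n i =
  (toℕ i ≡ 0) Data.Sum.⊎ (toℕ i ≡ m ∸ 1) Data.Sum.⊎ (toℕ i ≡ m) Data.Sum.⊎ (toℕ i ≡ m + n ∸ 1)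
  where import Data.Sum

Stitched : (m n : ℕ) → OrderedGraph (m + n) → Set
Stitched m n G = ∀ i j → Endpoint m n i → Endpoint m n j → Connected G i j

-- Split the N ≤ 5r vertices of K_N into five intervals B₀,…,B₄ of at most r
-- vertices and colour an edge true iff it joins B₀ to B₄, or two of B₁,B₂,B₃
-- that are equal or adjacent. In an ordered copy of G, v₁ and v_m lie in
-- different blocks, and so do v_{m+1} and v_{m+n}. If all edges of the copy
-- are false, v_m v_{m+1} must join B₁ to B₃, pushing v₁ into B₀ and v_{m+n}
-- into B₄, where v₁ v_{m+n} would be true. If all are true, v₁ v_{m+n}
-- forces v₁ into B₀, yet true edges never join {B₀,B₄} to the middle blocks,
-- so the path from v₁ to v_m given by stitchedness cannot reach v_m, which
-- lies in a middle block.
module Submission where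

open import Defs
open import Data.Nat using (ℕ; zero; suc; _+_; _*_; _∸_; _⊓_; _≤_; _<_; z≤n; s≤s; NonZero)
open import Data.Nat.Properties
open import Data.Nat.DivMod using (_/_; /-monoˡ-≤; m/n≡1+[m∸n]/n; m<n*o⇒m/o<n)
open import Data.Fin using (Fin; toℕ; fromℕ<)
open import Data.Fin.Properties using (toℕ-injective; toℕ-fromℕ<; toℕ<n)
open import Data.Bool using (Bool; true; false)
open import Data.Product using (_×_; _,_)
open import Data.Sum using (_⊎_; inj₁; inj₂)
open import Data.Empty using (⊥)
open import Relation.Nullary using (¬_; contradiction)
open import Relation.Binary using (tri<; tri≈; tri>)
open import Relation.Binary.PropositionalEquality using (_≡_; _≢_; refl; sym; trans; cong; subst; subst₂)

blockColour : ℕ → ℕ → Bool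
blockColour 0 4 = true
blockColour 1 1 = true
blockColour 1 2 = true
blockColour 2 2 = true
blockColour 2 3 = true
blockColour 3 3 = true
blockColour _ _ = false

isOuter : ℕ → Bool
isOuter 0 = true
isOuter 4 = true
isOuter _ = false

blockColour-true⇒isOuter-≡ : ∀ x y → blockColour x y ≡ true → isOuter x ≡ isOuter y
blockColour-true⇒isOuter-≡ 0 4 _ = refl
blockColour-true⇒isOuter-≡ 1 1 _ = refl
blockColour-true⇒isOuter-≡ 1 2 _ = refl
blockColour-true⇒isOuter-≡ 2 2 _ = refl
blockColour-true⇒isOuter-≡ 2 3 _ = refl
blockColour-true⇒isOuter-≡ 3 3 _ = refl

blockColour-true-wide⇒≡0 : ∀ {x y} → 2 + x ≤ y → blockColour x y ≡ true → x ≡ 0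
blockColour-true-wide⇒≡0 {0} _ _ = refl
blockColour-true-wide⇒≡0 {1} (s≤s (s≤s (s≤s _))) ()
blockColour-true-wide⇒≡0 {2} (s≤s (s≤s (s≤s (s≤s _)))) ()
blockColour-true-wide⇒≡0 {3} (s≤s (s≤s (s≤s (s≤s (s≤s _))))) ()

isOuter-middle : ∀ {x} → 1 ≤ x → x ≤ 3 → isOuter x ≡ false
isOuter-middle {1} _ _ = refl
isOuter-middle {2} _ _ = refl
isOuter-middle {3} _ _ = refl
isOuter-middle {suc (suc (suc (suc _)))} _ (s≤s (s≤s (s≤s ())))

blockColour-false-middle : ∀ {q s} → 1 ≤ q → q ≤ s → s ≤ 3 →
                           blockColour q s ≡ false → q ≡ 1 × s ≡ 3
blockColour-false-middle {1} {3} _ _ _ _ = refl , refl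
blockColour-false-middle {1} {1} _ _ _ ()
blockColour-false-middle {1} {2} _ _ _ ()
blockColour-false-middle {2} {2} _ _ _ ()
blockColour-false-middle {2} {3} _ _ _ ()
blockColour-false-middle {3} {3} _ _ _ ()
blockColour-false-middle {_} {suc (suc (suc (suc _)))} _ _ (s≤s (s≤s (s≤s ()))) _
blockColour-false-middle {suc (suc _)} {1} _ (s≤s ()) _ _
blockColour-false-middle {suc (suc (suc _))} {2} _ (s≤s (s≤s ())) _ _
blockColour-false-middle {suc (suc (suc (suc _)))} {3} _ (s≤s (s≤s (s≤s ()))) _ _

BlocksNested : ℕ → ℕ → ℕ → ℕ → Set
BlocksNested p q s t = p < q × q ≤ s × s < t × t ≤ 4

blockColour-false-nested⇒⊥ : ∀ {p q s t} → BlocksNested p q s t →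
                             blockColour p t ≡ false → blockColour q s ≡ false → ⊥
blockColour-false-nested⇒⊥ (p<q , q≤s , s<t , t≤4) pt qs
  with blockColour-false-middle (<-≤-trans (s≤s z≤n) p<q) q≤s (m<1+n⇒m≤n (<-≤-trans s<t t≤4)) qs
... | refl , refl with n<1⇒n≡0 p<q | ≤-antisym t≤4 s<t
... | refl | refl with () ← pt

blockColour-true-nested⇒isOuter-≢ : ∀ {p q s t} → BlocksNested p q s t →
                                    blockColour p t ≡ true → isOuter p ≢ isOuter q
blockColour-true-nested⇒isOuter-≢ (p<q , q≤s , s<t , t≤4) pt outer-p≡outer-q
  with blockColour-true-wide⇒≡0 (≤-trans (s≤s p<q) (≤-<-trans q≤s s<t)) pt
... | refl with () ← trans outer-p≡outer-q
                        (isOuter-middle p<q (m<1+n⇒m≤n (<-≤-trans (≤-<-trans q≤s s<t) t≤4)))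

m+n≤o⇒m/n<o/n : ∀ {m n o} .{{_ : NonZero n}} → m + n ≤ o → m / n < o / n
m+n≤o⇒m/n<o/n {m} {n} {o} m+n≤o = begin
  suc (m / n)       ≤⟨ s≤s (/-monoˡ-≤ n (m+n≤o⇒m≤o∸n m m+n≤o)) ⟩
  suc ((o ∸ n) / n) ≡⟨ m/n≡1+[m∸n]/n (m+n≤o⇒n≤o m m+n≤o) ⟨
  o / n             ∎
  where open ≤-Reasoning

StrictlyIncreasing : ∀ {k N} → (Fin k → Fin N) → Set
StrictlyIncreasing f = ∀ i j → toℕ i < toℕ j → toℕ (f i) < toℕ (f j)

module _ {k N} {f : Fin k → Fin N} (inc : StrictlyIncreasing f) where

  strictlyIncreasing⇒monotone : ∀ {i j} → toℕ i ≤ toℕ j → toℕ (f i) ≤ toℕ (f j)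
  strictlyIncreasing⇒monotone {i} {j} i≤j with m≤n⇒m<n∨m≡n i≤j
  ... | inj₁ i<j = <⇒≤ (inc i j i<j)
  ... | inj₂ i≡j rewrite toℕ-injective i≡j = ≤-refl

  strictlyIncreasing-+ : ∀ d {i j} → toℕ i + d ≤ toℕ j → toℕ (f i) + d ≤ toℕ (f j)
  strictlyIncreasing-+ zero {i} {j} i+0≤j rewrite +-identityʳ (toℕ i) | +-identityʳ (toℕ (f i)) =
    strictlyIncreasing⇒monotone i+0≤j
  strictlyIncreasing-+ (suc d) {i} {j} i+1+d≤j = begin
    toℕ (f i) + suc d   ≡⟨ +-suc (toℕ (f i)) d ⟩
    suc (toℕ (f i) + d) ≤⟨ s≤s (strictlyIncreasing-+ d (≤-reflexive (sym toℕ-j′))) ⟩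
    suc (toℕ (f j′))    ≤⟨ inc j′ j (subst (_< toℕ j) (sym toℕ-j′) i+d<j) ⟩
    toℕ (f j)           ∎
    where
    open ≤-Reasoning
    i+d<j : toℕ i + d < toℕ j
    i+d<j = subst (_≤ toℕ j) (+-suc (toℕ i) d) i+1+d≤j
    i+d<k : toℕ i + d < k
    i+d<k = <-trans i+d<j (toℕ<n j)
    j′ : Fin k
    j′ = fromℕ< i+d<k
    toℕ-j′ : toℕ j′ ≡ toℕ i + d
    toℕ-j′ = toℕ-fromℕ< i+d<k

E⇒<⊎> : ∀ {k} (G : OrderedGraph k) {u v} → E G u v → toℕ u < toℕ v ⊎ toℕ v < toℕ u
E⇒<⊎> G {u} {v} e with <-cmp (toℕ u) (toℕ v)
... | tri< u<v _ _ = inj₁ u<v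
... | tri≈ _ u≡v _ = contradiction (subst (E G u) (sym (toℕ-injective u≡v)) e) (E-irr G)
... | tri> _ _ v<u = inj₂ v<u

Connected⇒≡ : ∀ {k} {G : OrderedGraph k} {A : Set} (φ : Fin k → A) →
              (∀ {u v} → E G u v → φ u ≡ φ v) → ∀ {u v} → Connected G u v → φ u ≡ φ v
Connected⇒≡ φ edge here       = refl
Connected⇒≡ φ edge (step e w) = trans (edge e) (Connected⇒≡ φ edge w)

module FiveBlocks (r : ℕ) .{{_ : NonZero r}} (N : ℕ) (N≤5r : N ≤ 5 * r) where

  block : Fin N → ℕ
  block x = toℕ x / r

  colouring : Fin N → Fin N → Bool
  colouring x y = blockColour (block x) (block y)

  block≤4 : ∀ x → block x ≤ 4
  block≤4 x = m<1+n⇒m≤n (m<n*o⇒m/o<n (<-≤-trans (toℕ<n x) N≤5r))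

  module _ {k} (G : OrderedGraph k) {a b c d : Fin k}
           (a+r≤b : toℕ a + r ≤ toℕ b) (b<c : toℕ b < toℕ c) (c+r≤d : toℕ c + r ≤ toℕ d)
           (ad : E G a d) (bc : E G b c) (a~b : Connected G a b) where

    a<d : toℕ a < toℕ d
    a<d = ≤-<-trans (m+n≤o⇒m≤o (toℕ a) a+r≤b) (<-≤-trans b<c (m+n≤o⇒m≤o (toℕ c) c+r≤d))

    image-nested : ∀ {f : Fin k → Fin N} → StrictlyIncreasing f →
                   BlocksNested (block (f a)) (block (f b)) (block (f c)) (block (f d))
    image-nested {f} inc =
      m+n≤o⇒m/n<o/n (strictlyIncreasing-+ inc r a+r≤b) ,
      /-monoˡ-≤ r (<⇒≤ (inc b c b<c)) ,
      m+n≤o⇒m/n<o/n (strictlyIncreasing-+ inc r c+r≤d) ,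
      block≤4 (f d)

    no-monochromatic-copy : ∀ β → ¬ MonoCopy G N colouring β
    no-monochromatic-copy false (f , inc , blue) =
      blockColour-false-nested⇒⊥ (image-nested inc) (blue a d a<d ad) (blue b c b<c bc)
    no-monochromatic-copy true (f , inc , red) =
      blockColour-true-nested⇒isOuter-≢ (image-nested inc) (red a d a<d ad)
        (Connected⇒≡ (λ u → isOuter (block (f u))) red-edge a~b)
      where
      red-edge : ∀ {u v} → E G u v → isOuter (block (f u)) ≡ isOuter (block (f v))
      red-edge {u} {v} e with E⇒<⊎> G e
      ... | inj₁ u<v = blockColour-true⇒isOuter-≡ _ _ (red u v u<v e)
      ... | inj₂ v<u = sym (blockColour-true⇒isOuter-≡ _ _ (red v u v<u (E-sym G e)))

ramseyProp⇒5r<N : ∀ {k} (G : OrderedGraph k) {a b c d : Fin k} r →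
                  toℕ a + r ≤ toℕ b → toℕ b < toℕ c → toℕ c + r ≤ toℕ d →
                  E G a d → E G b c → Connected G a b →
                  ∀ {N} → RamseyProp G N → 5 * r < N
ramseyProp⇒5r<N G {a} zero _ _ _ _ _ _ {zero} R with R (λ ())
... | _ , f , _ with () ← f a
ramseyProp⇒5r<N G zero _ _ _ _ _ _ {suc N} R = s≤s z≤n
ramseyProp⇒5r<N G r@(suc _) a+r≤b b<c c+r≤d ad bc a~b {N} R = ≰⇒> λ N≤5r →
  let β , copy = R (colouring r N N≤5r)
  in no-monochromatic-copy r N N≤5r G a+r≤b b<c c+r≤d ad bc a~b β copy
  where open FiveBlocks

ramseyProp⇒5[m⊓n]<N : ∀ m′ n′ (G : OrderedGraph (suc m′ + suc n′)) →
                       (∀ i j → toℕ i ≡ 0 → toℕ j ≡ m′ + suc n′ → E G i j) →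
                       (∀ i j → toℕ i ≡ m′ → toℕ j ≡ suc m′ → E G i j) →
                       (∀ i j → toℕ i ≡ 0 → toℕ j ≡ m′ → Connected G i j) →
                       ∀ {N} → RamseyProp G N → 5 * (m′ ⊓ n′) < N
ramseyProp⇒5[m⊓n]<N m′ n′ G first-last middle first~endˡ =
  ramseyProp⇒5r<N G r r≤endˡ endˡ<startʳ startʳ+r≤last
    (first-last first last refl toℕ-last) (middle endˡ startʳ toℕ-endˡ toℕ-startʳ)
    (first~endˡ first endˡ refl toℕ-endˡ)
  where
  r : ℕ
  r = m′ ⊓ n′
  first endˡ startʳ last : Fin (suc m′ + suc n′)
  first = fromℕ< {0} (s≤s z≤n)
  endˡ = fromℕ< {m′} (s≤s (m≤m+n m′ (suc n′)))
  startʳ = fromℕ< {suc m′} (s≤s (m<m+n m′ (s≤s z≤n)))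
  last = fromℕ< {m′ + suc n′} ≤-refl
  toℕ-endˡ : toℕ endˡ ≡ m′
  toℕ-endˡ = toℕ-fromℕ< _
  toℕ-startʳ : toℕ startʳ ≡ suc m′
  toℕ-startʳ = cong suc (toℕ-fromℕ< _)
  toℕ-last : toℕ last ≡ m′ + suc n′
  toℕ-last = toℕ-fromℕ< _
  r≤endˡ : r ≤ toℕ endˡ
  r≤endˡ = subst (r ≤_) (sym toℕ-endˡ) (m⊓n≤m m′ n′)
  endˡ<startʳ : toℕ endˡ < toℕ startʳ
  endˡ<startʳ = subst₂ _<_ (sym toℕ-endˡ) (sym toℕ-startʳ) ≤-refl
  startʳ+r≤last : toℕ startʳ + r ≤ toℕ last
  startʳ+r≤last = subst₂ (λ x y → x + r ≤ y) (sym toℕ-startʳ) (sym toℕ-last)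
    (≤-trans (s≤s (+-monoʳ-≤ m′ (m⊓n≤n m′ n′))) (≤-reflexive (sym (+-suc m′ n′))))

corollary1 : (m n : ℕ) (G : OrderedGraph (m + n)) →
    TwoIchromaticParts m n G →
    Stitched m n G →
    (∀ (i j : Fin (m + n)) → toℕ i ≡ 0 → toℕ j ≡ m + n ∸ 1 → E G i j) →
    (∀ (i j : Fin (m + n)) → toℕ i ≡ m ∸ 1 → toℕ j ≡ m → E G i j) →
    RamseyGE G (5 * (m ⊓ n ∸ 1) + 1)
corollary1 zero _ _ (() , _) _ _ _
corollary1 (suc _) zero _ (_ , () , _) _ _ _
corollary1 (suc m′) (suc n′) G _ stitched first-last middle N R =
  subst (_≤ N) (+-comm 1 (5 * (m′ ⊓ n′)))
    (ramseyProp⇒5[m⊓n]<N m′ n′ G first-last middle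
      (λ i j i≡0 j≡m′ → stitched i j (inj₁ i≡0) (inj₂ (inj₁ j≡m′))) R)
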